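{- Let $p$ be an odd prime, $r\ge1$, $e$ a divisor of $p-1$, $R=\mathbb{Z}/p^r\mathbb{Z}$, $H$ the unique subgroup of order $e$ of $R^*$ acting on $R$ by multiplication, $S=\mathbb{Z}/p^{r-1}\mathbb{Z}$ with $H$ acting by $h\cdot s=\pi(h)s$ where $\pi:R\to S$ is the projection, and $\rho:R/H\to S/H$, $\rho(Hx)=H\pi(x)$. For $\mathbf{y}\in S/H$, \[ |\rho^{ -1}(\mathbf{y})|=\begin{cases}1+\frac{p-1}{e} & \text{if } \mathbf{y}=\mathbf{0},\\ p & \text{if } \mathbf{y}\neq\mathbf{0},\end{cases}\] where $\mathbf{0}$ is the zero orbit of $S$. -}

module Defs where

open import Data.Nat using (ℕ; zero; suc; _*_; _<_; _%_)
open import Data.List using (List; length)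
open import Data.List.Membership.Propositional using (_∈_)
open import Data.List.Relation.Unary.All using (All)
open import Data.List.Relation.Unary.Any using (Any)
open import Data.List.Relation.Unary.AllPairs using (AllPairs)
open import Data.List.Relation.Unary.Unique.Propositional using (Unique)
open import Data.Product using (Σ; ∃-syntax; _×_)
open import Relation.Binary.PropositionalEquality using (_≡_)
open import Relation.Nullary using (¬_)

-- Reduction modulo n, i.e. the canonical representative in {0,…,n-1}
-- of the class of x in ℤ/nℤ.  (The n = 0 clause is a convention that is
-- never used: all moduli below are p^k ≥ 1.)
_mod_ : ℕ → ℕ → ℕ
x mod zero    = x
x mod (suc n) = x % suc n

-- H ⊆ (ℤ/Nℤ)^* is a subgroup of order e, given as the duplicate-free list
-- of its elements (canonical representatives in {0,…,N-1}).
record IsUnitSubgroup (N e : ℕ) (H : List ℕ) : Set where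
  field
    elems-lt : All (_< N) H
    distinct : Unique H
    order    : length H ≡ e
    has-one  : (1 mod N) ∈ H
    mul-closed : ∀ {a b} → a ∈ H → b ∈ H → ((a * b) mod N) ∈ H
    inverses : ∀ {a} → a ∈ H → ∃[ b ] (b ∈ H × (a * b) mod N ≡ 1 mod N)

OrbR : ℕ → List ℕ → ℕ → ℕ → Set
OrbR N H x y = ∃[ h ] (h ∈ H × (h * x) mod N ≡ y)

OrbS : ℕ → List ℕ → ℕ → ℕ → Set
OrbS M H s t = ∃[ h ] (h ∈ H × ((h mod M) * s) mod M ≡ t)

-- L is a list of representatives of the fibre ρ⁻¹(H s) ⊆ R/H, where
-- R = ℤ/Nℤ, S = ℤ/Mℤ, π(x) = x mod M, ρ(H x) = H π(x):
-- every element of L lies in R and its orbit maps to H s; distinct elements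
-- of L lie in distinct H-orbits; every orbit of R mapping to H s is the
-- orbit of some element of L.
record FiberReps (N M : ℕ) (H : List ℕ) (s : ℕ) (L : List ℕ) : Set where
  field
    reps-lt    : All (_< N) L
    reps-fiber : All (λ x → OrbS M H s (x mod M)) L
    reps-distinct : AllPairs (λ x y → ¬ OrbR N H x y) L
    reps-cover : ∀ x → x < N → OrbS M H s (x mod M) → Any (λ z → OrbR N H z x) L

FiberCard : ℕ → ℕ → List ℕ → ℕ → ℕ → Set
FiberCard N M H s n = Σ (List ℕ) (λ L → FiberReps N M H s L × length L ≡ n)

-- Everything rests on H meeting the kernel of R* → (ℤ/pℤ)* trivially: if
-- g = 1 + a ∈ H with p ∣ a, then g has some order d ≤ e < p, and since
-- (1 + a)^d ≡ 1 + d a (mod a²) with p ∤ d, from p^k ∣ a we get p^(k+1) ∣ a,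
-- until a ≡ 0 (mod p^r), i.e. g = 1.  Hence an element of H fixing some
-- x ≢ 0 (mod p^k) is 1.
--
-- Over s ≠ 0 this makes the p lifts s + k p^(r-1) lie in distinct H-orbits,
-- and every orbit over H s contains one of them.  Over 0 the fibre is π⁻¹(0)
-- = {k p^(r-1)}: the orbit {0} together with the p - 1 nonzero elements, on
-- which H acts freely, so they form (p - 1)/e orbits of size e.
module Submission where

open import Defs
open import Data.Nat
open import Data.Nat.Properties
open import Data.Nat.DivMod hiding (_mod_)
open import Data.Nat.Divisibility
open import Data.Nat.Primality
open import Data.Nat.Tactic.RingSolver using (solve-∀)
open import Data.Product using (∃-syntax; _×_; _,_; proj₁; proj₂)
open import Data.Sum using (inj₁; inj₂)
open import Data.Empty using (⊥-elim)
open import Data.Fin using (toℕ)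
import Data.Fin.Properties as Fin
open import Data.List using (List; []; _∷_; length; map; filter; concat; applyUpTo; lookup)
open import Data.List.Properties using (length-applyUpTo; length-++; length-map; filter-notAll)
open import Data.List.Membership.Propositional using (_∈_; lose)
open import Data.List.Membership.Propositional.Properties
open import Data.List.Relation.Unary.Any as Any using (Any; here; there)
open import Data.List.Relation.Unary.Any.Properties using (lookup-index)
open import Data.List.Relation.Unary.All as All using (All; []; _∷_)
import Data.List.Relation.Unary.All.Properties as All
open import Data.List.Relation.Unary.AllPairs using (AllPairs; []; _∷_)
import Data.List.Relation.Unary.AllPairs.Properties as AllPairs
open import Data.List.Relation.Unary.Unique.Propositional using (Unique)
import Data.List.Relation.Unary.Unique.Propositional.Properties as Unique
open import Data.List.Relation.Binary.Disjoint.Propositional using (Disjoint)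
open import Data.List.Relation.Binary.Subset.Propositional using (_⊆_)
open import Data.List.Extrema.Nat using (argmin; argmin-all; f[argmin]≤f[xs])
open import Relation.Nullary using (¬_; Dec; yes; no; ¬?)
open import Relation.Binary.PropositionalEquality

private
  variable
    a b d g h h′ k m x y : ℕ

AllPairs-map∈ : {R S : ℕ → ℕ → Set} {xs : List ℕ} →
                (∀ {x y} → x ∈ xs → y ∈ xs → R x y → S x y) →
                AllPairs R xs → AllPairs S xs
AllPairs-map∈ f []         = []
AllPairs-map∈ f (rx ∷ rxs) =
  All.tabulate (λ y∈ → f (here refl) (there y∈) (All.lookup rx y∈))
  ∷ AllPairs-map∈ (λ x∈ y∈ → f (there x∈) (there y∈)) rxs

Unique-⊆⇒length≤ : {xs ys : List ℕ} → Unique xs → xs ⊆ ys → length xs ≤ length ys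
Unique-⊆⇒length≤ {[]} _ _ = z≤n
Unique-⊆⇒length≤ {x ∷ xs} {ys} (x∉xs ∷ xs!) xs⊆ys =
  ≤-trans (s≤s (Unique-⊆⇒length≤ xs! xs⊆ys-x)) (filter-notAll ≢x? ys x∈ys)
  where
  ≢x? = λ y → ¬? (y ≟ x)
  xs⊆ys-x : xs ⊆ filter ≢x? ys
  xs⊆ys-x v∈ = ∈-filter⁺ ≢x? (xs⊆ys (there v∈)) (λ v≡x → All.lookup x∉xs v∈ (sym v≡x))
  x∈ys = Any.map (λ { refl x≢x → x≢x refl }) (xs⊆ys (here refl))

-- Congruences

mod≡% : ∀ m n .{{_ : NonZero n}} → m mod n ≡ m % n
mod≡% m (suc n) = refl

%≡%⇒∣∸ : ∀ m n d .{{_ : NonZero d}} → m % d ≡ n % d → d ∣ m ∸ n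
%≡%⇒∣∸ m n d eq = divides (m / d ∸ n / d) (begin
  m ∸ n                                      ≡⟨ cong₂ _∸_ (m≡m%n+[m/n]*n m d) (m≡m%n+[m/n]*n n d) ⟩
  (m % d + m / d * d) ∸ (n % d + n / d * d)  ≡⟨ cong (λ t → (m % d + m / d * d) ∸ (t + n / d * d)) (sym eq) ⟩
  (m % d + m / d * d) ∸ (m % d + n / d * d)  ≡⟨ [m+n]∸[m+o]≡n∸o (m % d) _ _ ⟩
  m / d * d ∸ n / d * d                      ≡⟨ *-distribʳ-∸ d (m / d) (n / d) ⟨
  (m / d ∸ n / d) * d                        ∎)
  where open ≡-Reasoning

%-reduce : ∀ m n {c d} .{{_ : NonZero c}} .{{_ : NonZero d}} → c ∣ d →
           m % d ≡ n % d → m % c ≡ n % c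
%-reduce m n {c} {d} c∣d eq = begin
  m % c      ≡⟨ m∣n⇒o%n%m≡o%m c d m c∣d ⟨
  m % d % c  ≡⟨ cong (_% c) eq ⟩
  n % d % c  ≡⟨ m∣n⇒o%n%m≡o%m c d n c∣d ⟩
  n % c      ∎
  where open ≡-Reasoning

act : (n : ℕ) .{{_ : NonZero n}} → ℕ → ℕ → ℕ
act n h x = (h * x) % n

module _ (n : ℕ) .{{_ : NonZero n}} where

  act-%ʳ : ∀ h x → act n h (x % n) ≡ act n h x
  act-%ʳ h x = begin
    (h * (x % n)) % n            ≡⟨ %-distribˡ-* h (x % n) n ⟩
    ((h % n) * (x % n % n)) % n  ≡⟨ cong (λ t → ((h % n) * t) % n) (m%n%n≡m%n x n) ⟩
    ((h % n) * (x % n)) % n      ≡⟨ %-distribˡ-* h x n ⟨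
    (h * x) % n                  ∎
    where open ≡-Reasoning

  act-%ˡ : ∀ h x → act n (h % n) x ≡ act n h x
  act-%ˡ h x = begin
    ((h % n) * x) % n  ≡⟨ cong (_% n) (*-comm (h % n) x) ⟩
    (x * (h % n)) % n  ≡⟨ act-%ʳ x h ⟩
    (x * h) % n        ≡⟨ cong (_% n) (*-comm x h) ⟩
    (h * x) % n        ∎
    where open ≡-Reasoning

  act-∘ : ∀ h g x → act n h (act n g x) ≡ act n (h * g) x
  act-∘ h g x = trans (act-%ʳ h (g * x)) (cong (_% n) (sym (*-assoc h g x)))

  act-1 : ∀ x → act n 1 x ≡ x % n
  act-1 x = cong (_% n) (*-identityˡ x)

  act-0 : ∀ h → act n h 0 ≡ 0
  act-0 h = trans (cong (_% n) (*-zeroʳ h)) (m<n⇒m%n≡m (>-nonZero⁻¹ n))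

  act-inverse : ∀ b h x → (b * h) % n ≡ 1 % n → act n b (act n h x) ≡ x % n
  act-inverse b h x bh≡1 = begin
    act n b (act n h x)    ≡⟨ act-∘ b h x ⟩
    act n (b * h) x        ≡⟨ act-%ˡ (b * h) x ⟨
    act n ((b * h) % n) x  ≡⟨ cong (λ t → act n t x) bh≡1 ⟩
    act n (1 % n) x        ≡⟨ act-%ˡ 1 x ⟩
    act n 1 x              ≡⟨ act-1 x ⟩
    x % n                  ∎
    where open ≡-Reasoning

  act-transfer : ∀ b h h′ x y → (b * h′) % n ≡ 1 % n → act n h x ≡ act n h′ y →
                 act n (act n b h) x ≡ y % n
  act-transfer b h h′ x y bh′≡1 hx≡h′y = begin
    act n ((b * h) % n) x  ≡⟨ act-%ˡ (b * h) x ⟩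
    act n (b * h) x        ≡⟨ act-∘ b h x ⟨
    act n b (act n h x)    ≡⟨ cong (act n b) hx≡h′y ⟩
    act n b (act n h′ y)   ≡⟨ act-inverse b h′ y bh′≡1 ⟩
    y % n                  ∎
    where open ≡-Reasoning

  act-inverse′ : ∀ b h x → (b * h) % n ≡ 1 % n → act n h (act n b x) ≡ x % n
  act-inverse′ b h x bh≡1 = act-inverse h b x (trans (cong (_% n) (*-comm h b)) bh≡1)

  mod-scale≡act : ∀ h x → ((h mod n) * x) mod n ≡ act n h x
  mod-scale≡act h x =
    trans (mod≡% (h mod n * x) n) (trans (cong (λ t → act n t x) (mod≡% h n)) (act-%ˡ h x))

-- Prime powers

prime^-divisor : ∀ {p} m → Prime p → ¬ p ∣ a → p ^ m ∣ a * b → p ^ m ∣ b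
prime^-divisor         zero    _     _   _ = 1∣ _
prime^-divisor {a} {b} {p} (suc m) p-prime p∤a pᵐ⁺¹∣ab
  with euclidsLemma a b p-prime (∣-trans (m∣m*n (p ^ m)) pᵐ⁺¹∣ab)
... | inj₁ p∣a = ⊥-elim (p∤a p∣a)
... | inj₂ (divides q refl) = subst (_∣ q * p) (*-comm (p ^ m) p) (*-monoˡ-∣ p pᵐ∣q)
  where
  instance _ = prime⇒nonZero p-prime
  pᵐ∣q : p ^ m ∣ q
  pᵐ∣q = prime^-divisor m p-prime p∤a (*-cancelʳ-∣ p
           (subst₂ _∣_ (*-comm p (p ^ m)) (sym (*-assoc a q p)) pᵐ⁺¹∣ab))

[1+a]^d-expansion : ∀ a d → ∃[ c ] ((1 + a) ^ d ≡ 1 + d * a + a * a * c)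
[1+a]^d-expansion a zero    = 0 , cong suc (sym (*-zeroʳ (a * a)))
[1+a]^d-expansion a (suc d) with [1+a]^d-expansion a d
... | c , eq = c + d + a * c , trans (cong ((1 + a) *_) eq) (step a d c)
  where
  step : ∀ a d c → (1 + a) * (1 + d * a + a * a * c) ≡ 1 + suc d * a + a * a * (c + d + a * c)
  step = solve-∀

p^m∣[1+a]^d∸1⇒p^m∣a : ∀ {p} → Prime p → p ∣ a → ¬ p ∣ d →
                      ∀ m → p ^ m ∣ (1 + a) ^ d ∸ 1 → p ^ m ∣ a
p^m∣[1+a]^d∸1⇒p^m∣a                 _     _   _   zero    _ = 1∣ _
p^m∣[1+a]^d∸1⇒p^m∣a {a} {d} {p} p-prime p∣a p∤d (suc m) pᵐ⁺¹∣ =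
  prime^-divisor (suc m) p-prime p∤d pᵐ⁺¹∣da
  where
  pᵐ∣a : p ^ m ∣ a
  pᵐ∣a = p^m∣[1+a]^d∸1⇒p^m∣a p-prime p∣a p∤d m (∣-trans (n∣m*n p) pᵐ⁺¹∣)
  c = proj₁ ([1+a]^d-expansion a d)
  pᵐ⁺¹∣da+aac : p ^ suc m ∣ d * a + a * a * c
  pᵐ⁺¹∣da+aac = subst (p ^ suc m ∣_) (cong (_∸ 1) (proj₂ ([1+a]^d-expansion a d))) pᵐ⁺¹∣
  pᵐ⁺¹∣da : p ^ suc m ∣ d * a
  pᵐ⁺¹∣da = ∣m+n∣m⇒∣n (subst (p ^ suc m ∣_) (+-comm (d * a) _) pᵐ⁺¹∣da+aac)
                      (∣m⇒∣m*n c (*-pres-∣ p∣a pᵐ∣a))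

-- Orbits of a subgroup of (ℤ/Nℤ)*

module UnitSubgroup {N e : ℕ} {H : List ℕ} .{{_ : NonZero N}} (G : IsUnitSubgroup N e H) where
  open IsUnitSubgroup G

  ∈H⇒<N : h ∈ H → h < N
  ∈H⇒<N = All.lookup elems-lt

  1%N∈H : 1 % N ∈ H
  1%N∈H = subst (_∈ H) (mod≡% 1 N) has-one

  act-∈H : g ∈ H → h ∈ H → act N g h ∈ H
  act-∈H g∈H h∈H = subst (_∈ H) (mod≡% _ N) (mul-closed g∈H h∈H)

  inverse : h ∈ H → ∃[ b ] (b ∈ H × (b * h) % N ≡ 1 % N)
  inverse {h} h∈H with inverses h∈H
  ... | b , b∈H , hb≡1 = b , b∈H ,
    trans (cong (_% N) (*-comm b h)) (trans (sym (mod≡% (h * b) N)) (trans hb≡1 (mod≡% 1 N)))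

  act-cancel : h ∈ H → act N h x ≡ act N h y → x % N ≡ y % N
  act-cancel {h} {x} {y} h∈H eq with inverse h∈H
  ... | b , _ , bh≡1 =
    trans (sym (act-inverse N b h x bh≡1)) (trans (cong (act N b) eq) (act-inverse N b h y bh≡1))

  ^-∈H : g ∈ H → ∀ k → (g ^ k) % N ∈ H
  ^-∈H g∈H zero    = 1%N∈H
  ^-∈H {g} g∈H (suc k) = subst (_∈ H) (act-%ʳ N g (g ^ k)) (act-∈H g∈H (^-∈H g∈H k))

  finite-order : g ∈ H → ∃[ d ] (1 ≤ d × d ≤ e × N ∣ g ^ d ∸ 1)
  finite-order {g} g∈H
    with Fin.pigeonhole (n<1+n (length H)) (λ i → Any.index (^-∈H g∈H (toℕ i)))
  ... | i′ , j′ , i<j , same-index = j ∸ i , m<n⇒0<n∸m i<j , d≤e , %≡%⇒∣∸ _ 1 N gᵈ≡1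
    where
    open ≡-Reasoning
    i = toℕ i′
    j = toℕ j′
    d≤e : j ∸ i ≤ e
    d≤e = ≤-trans (m∸n≤m j i) (subst (j ≤_) order (≤-pred (Fin.toℕ<n j′)))
    gⁱ≡gʲ : (g ^ i) % N ≡ (g ^ j) % N
    gⁱ≡gʲ = trans (lookup-index (^-∈H g∈H i))
           (trans (cong (lookup H) same-index) (sym (lookup-index (^-∈H g∈H j))))
    gᵈ≡1 : (g ^ (j ∸ i)) % N ≡ 1 % N
    gᵈ≡1 = act-cancel (^-∈H g∈H i) (begin
      act N ((g ^ i) % N) (g ^ (j ∸ i))  ≡⟨ act-%ˡ N (g ^ i) _ ⟩
      (g ^ i * g ^ (j ∸ i)) % N          ≡⟨ cong (_% N) (^-distribˡ-+-* g i (j ∸ i)) ⟨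
      (g ^ (i + (j ∸ i))) % N            ≡⟨ cong (λ t → (g ^ t) % N) (m+[n∸m]≡n (<⇒≤ i<j)) ⟩
      (g ^ j) % N                        ≡⟨ gⁱ≡gʲ ⟨
      (g ^ i) % N                        ≡⟨ cong (_% N) (*-identityʳ (g ^ i)) ⟨
      (g ^ i * 1) % N                    ≡⟨ act-%ˡ N (g ^ i) 1 ⟨
      act N ((g ^ i) % N) 1              ∎)

  orbitR : g ∈ H → act N g y ≡ x → OrbR N H y x
  orbitR {g} {y} g∈H eq = g , g∈H , trans (mod≡% (g * y) N) eq

  trivial-stabiliser⇒free : x < N → (∀ {g} → g ∈ H → act N g x ≡ x → g ≡ 1) →
                            h ∈ H → h′ ∈ H → act N h x ≡ act N h′ x → h ≡ h′
  trivial-stabiliser⇒free {x} {h} {h′} x<N stab h∈H h′∈H hx≡h′x with inverse h′∈H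
  ... | b , b∈H , bh′≡1 = begin
    h                        ≡⟨ m<n⇒m%n≡m (∈H⇒<N h∈H) ⟨
    h % N                    ≡⟨ act-inverse′ N b h′ h bh′≡1 ⟨
    act N h′ (act N b h)     ≡⟨ cong (act N h′) (stab (act-∈H b∈H h∈H) bh-fixes-x) ⟩
    act N h′ 1               ≡⟨ cong (_% N) (*-identityʳ h′) ⟩
    h′ % N                   ≡⟨ m<n⇒m%n≡m (∈H⇒<N h′∈H) ⟩
    h′                       ∎
    where
    open ≡-Reasoning
    bh-fixes-x : act N (act N b h) x ≡ x
    bh-fixes-x = trans (act-transfer N b h h′ x x bh′≡1 hx≡h′x) (m<n⇒m%n≡m x<N)

  module FreeOrbits (D : List ℕ) (D! : Unique D) (D<N : All (_< N) D)
                    (act-∈D : ∀ {h x} → h ∈ H → x ∈ D → act N h x ∈ D)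
                    (free : ∀ {h h′ x} → h ∈ H → h′ ∈ H → x ∈ D → act N h x ≡ act N h′ x → h ≡ h′)
                    where

    IsLeast : ℕ → Set
    IsLeast x = All (λ h → x ≤ act N h x) H

    least? : ∀ x → Dec (IsLeast x)
    least? x = All.all? (λ h → x ≤? act N h x) H

    reps : List ℕ
    reps = filter least? D

    reps⊆D : y ∈ reps → y ∈ D
    reps⊆D y∈ = proj₁ (∈-filter⁻ least? {xs = D} y∈)

    reps-least : y ∈ reps → IsLeast y
    reps-least y∈ = proj₂ (∈-filter⁻ least? {xs = D} y∈)

    least-unique : y < N → IsLeast y → IsLeast x → g ∈ H → act N g y ≡ x → y ≡ x
    least-unique {y} {x} {g} y<N y-least x-least g∈H gy≡x with inverse g∈H
    ... | b , b∈H , bg≡1 = ≤-antisym (subst (y ≤_) gy≡x (All.lookup y-least g∈H))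
      (subst (x ≤_) (trans (cong (act N b) (sym gy≡x))
                           (trans (act-inverse N b g y bg≡1) (m<n⇒m%n≡m y<N)))
             (All.lookup x-least b∈H))

    reps-inequivalent : AllPairs (λ y x → ¬ OrbR N H y x) reps
    reps-inequivalent = AllPairs-map∈ inequivalent (Unique.filter⁺ least? D!)
      where
      inequivalent : y ∈ reps → x ∈ reps → y ≢ x → ¬ OrbR N H y x
      inequivalent y∈ x∈ y≢x (g , g∈H , gy≡x) =
        y≢x (least-unique (All.lookup D<N (reps⊆D y∈)) (reps-least y∈) (reps-least x∈) g∈H
                          (trans (sym (mod≡% _ N)) gy≡x))

    reps-represent : x ∈ D → ∃[ y ] (y ∈ reps × OrbR N H y x)
    reps-represent {x} x∈D = represent (inverse g₀∈H)
      where
      g₀ = argmin (λ h → act N h x) (1 % N) H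
      g₀∈H : g₀ ∈ H
      g₀∈H = argmin-all (λ h → act N h x) 1%N∈H (All.tabulate (λ h∈H → h∈H))
      least : IsLeast (act N g₀ x)
      least = All.tabulate λ {h} h∈H →
        subst (act N g₀ x ≤_) (trans (act-%ˡ N (h * g₀) x) (sym (act-∘ N h g₀ x)))
              (All.lookup (f[argmin]≤f[xs] {f = λ h → act N h x} (1 % N) H) (act-∈H h∈H g₀∈H))
      represent : ∃[ b ] (b ∈ H × (b * g₀) % N ≡ 1 % N) → ∃[ y ] (y ∈ reps × OrbR N H y x)
      represent (b , b∈H , bg₀≡1) = act N g₀ x , ∈-filter⁺ least? (act-∈D g₀∈H x∈D) least ,
        orbitR b∈H (trans (act-inverse N b g₀ x bg₀≡1) (m<n⇒m%n≡m (All.lookup D<N x∈D)))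

    orbit : ℕ → List ℕ
    orbit y = map (λ h → act N h y) H

    orbits : List ℕ
    orbits = concat (map orbit reps)

    length-orbits : ∀ ys → length (concat (map orbit ys)) ≡ length ys * e
    length-orbits []       = refl
    length-orbits (y ∷ ys) =
      trans (length-++ (orbit y)) (cong₂ _+_ (trans (length-map _ H) order) (length-orbits ys))

    orbits! : Unique orbits
    orbits! = Unique.concat⁺
      (All.map⁺ (All.tabulate λ y∈ → AllPairs.map⁺
        (AllPairs-map∈ (λ h∈H h′∈H h≢h′ eq → h≢h′ (free h∈H h′∈H (reps⊆D y∈) eq)) distinct)))
      (AllPairs.map⁺ (AllPairs-map∈ disjoint (Unique.filter⁺ least? D!)))
      where
      disjoint : y ∈ reps → x ∈ reps → y ≢ x → Disjoint (orbit y) (orbit x)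
      disjoint {y} {x} y∈ x∈ y≢x (v∈y , v∈x) with ∈-map⁻ _ v∈y | ∈-map⁻ _ v∈x
      ... | h , h∈H , refl | h′ , h′∈H , hy≡h′x with inverse h′∈H
      ...   | b , b∈H , bh′≡1 = y≢x (least-unique (All.lookup D<N (reps⊆D y∈))
                                       (reps-least y∈) (reps-least x∈) (act-∈H b∈H h∈H)
                                       (trans (act-transfer N b h h′ y x bh′≡1 hy≡h′x)
                                              (m<n⇒m%n≡m (All.lookup D<N (reps⊆D x∈)))))

    orbits⊆D : orbits ⊆ D
    orbits⊆D x∈ with ∈-concat⁻′ (map orbit reps) x∈
    ... | xs , x∈xs , xs∈ with ∈-map⁻ orbit xs∈
    ...   | y , y∈ , refl with ∈-map⁻ _ x∈xs
    ...     | h , h∈H , refl = act-∈D h∈H (reps⊆D y∈)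

    D⊆orbits : D ⊆ orbits
    D⊆orbits {x} x∈D = in-orbits (reps-represent x∈D)
      where
      in-orbits : ∃[ y ] (y ∈ reps × OrbR N H y x) → x ∈ orbits
      in-orbits (y , y∈ , h , h∈H , hy≡x) = ∈-concat⁺′ {xss = map orbit reps} x∈orbit (∈-map⁺ orbit y∈)
        where
        x∈orbit : x ∈ orbit y
        x∈orbit = subst (_∈ orbit y) (trans (sym (mod≡% (h * y) N)) hy≡x) (∈-map⁺ (λ h → act N h y) h∈H)

    length-reps : length reps * e ≡ length D
    length-reps = trans (sym (length-orbits reps))
      (≤-antisym (Unique-⊆⇒length≤ orbits! orbits⊆D) (Unique-⊆⇒length≤ D! D⊆orbits))

-- The fibres of R/H → S/H for R = ℤ/p^(r+1)ℤ, S = ℤ/p^rℤ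

module PrimePowerModulus {p r e : ℕ} {H : List ℕ} (p-prime : Prime p) (e∣p∸1 : e ∣ p ∸ 1)
                         .{{_ : NonZero e}} (G : IsUnitSubgroup (p * p ^ r) e H) where

  M N : ℕ
  M = p ^ r
  N = p * M

  instance
    p≢0 : NonZero p
    p≢0 = prime⇒nonZero p-prime
    M≢0 : NonZero M
    M≢0 = m^n≢0 p r
    N≢0 : NonZero N
    N≢0 = m*n≢0 p M

  1<p : 1 < p
  1<p = nonTrivial⇒n>1 p {{prime⇒nonTrivial p-prime}}

  suc[p∸1]≡p : suc (p ∸ 1) ≡ p
  suc[p∸1]≡p = m+[n∸m]≡n (<⇒≤ 1<p)

  e<p : e < p
  e<p = <-≤-trans (s≤s (∣⇒≤ {{>-nonZero (m<n⇒0<n∸m 1<p)}} e∣p∸1)) (≤-reflexive suc[p∸1]≡p)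

  open UnitSubgroup G

  M∣N : M ∣ N
  M∣N = n∣m*n p

  1%N≡1 : 1 % N ≡ 1
  1%N≡1 = m<n⇒m%n≡m (<-≤-trans 1<p (m≤m*n p M))

  1∈H : 1 ∈ H
  1∈H = subst (_∈ H) 1%N≡1 1%N∈H

  orbitS : g ∈ H → act M g x ≡ y → OrbS M H x y
  orbitS {g} {x} g∈H eq = g , g∈H , trans (mod-scale≡act M g x) eq

  orbitS-0 : OrbS M H 0 y → y ≡ 0
  orbitS-0 (h , _ , h0≡y) = trans (sym h0≡y) (trans (mod-scale≡act M h 0) (act-0 M h))

  orbitS-refl : x % M ≡ y % M → OrbS M H x (y mod M)
  orbitS-refl {x} {y} eq = orbitS 1∈H (trans (act-1 M x) (trans eq (sym (mod≡% y M))))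

  act-π : ∀ h x → act N h x % M ≡ act M h x
  act-π h x = m∣n⇒o%n%m≡o%m M N (h * x) M∣N

  0∉H : ¬ 0 ∈ H
  0∉H 0∈H with inverse 0∈H
  ... | b , _ , b0≡1 = 0≢1+n (begin
    0          ≡⟨ act-0 N b ⟨
    act N b 0  ≡⟨ b0≡1 ⟩
    1 % N      ≡⟨ 1%N≡1 ⟩
    1          ∎)
    where open ≡-Reasoning

  ≡1[mod-p]⇒≡1 : g ∈ H → p ∣ g ∸ 1 → g ≡ 1
  ≡1[mod-p]⇒≡1 {zero} 0∈H _ = ⊥-elim (0∉H 0∈H)
  ≡1[mod-p]⇒≡1 {suc a} g∈H p∣a = cong suc (a≡0 (finite-order g∈H))
    where
    a≡0 : ∃[ d ] (1 ≤ d × d ≤ e × N ∣ suc a ^ d ∸ 1) → a ≡ 0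
    a≡0 (d , 1≤d , d≤e , N∣gᵈ∸1) = trans (sym (m<n⇒m%n≡m a<N)) (n∣m⇒m%n≡0 a N N∣a)
      where
      a<N : a < N
      a<N = <-trans (n<1+n a) (∈H⇒<N g∈H)
      p∤d : ¬ p ∣ d
      p∤d = >⇒∤ {{>-nonZero 1≤d}} (≤-<-trans d≤e e<p)
      N∣a : N ∣ a
      N∣a = p^m∣[1+a]^d∸1⇒p^m∣a p-prime p∣a p∤d (suc r) N∣gᵈ∸1

  stabiliser-trivial : ∀ m .{{_ : NonZero (p ^ m)}} → g ∈ H → ¬ p ^ m ∣ x →
                       act (p ^ m) g x ≡ x % p ^ m → g ≡ 1
  stabiliser-trivial {g} {x} m g∈H pᵐ∤x gx≡x with p ∣? (g ∸ 1)
  ... | yes p∣g∸1 = ≡1[mod-p]⇒≡1 g∈H p∣g∸1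
  ... | no  p∤g∸1 = ⊥-elim (pᵐ∤x (prime^-divisor m p-prime p∤g∸1 pᵐ∣[g∸1]x))
    where
    pᵐ∣[g∸1]x : p ^ m ∣ (g ∸ 1) * x
    pᵐ∣[g∸1]x = subst (p ^ m ∣_)
      (trans (cong (g * x ∸_) (sym (*-identityˡ x))) (sym (*-distribʳ-∸ x g 1)))
      (%≡%⇒∣∸ (g * x) x (p ^ m) gx≡x)

  module NonzeroFibre {s : ℕ} (0<s : 0 < s) (s<M : s < M) where

    lift : ℕ → ℕ
    lift k = s + k * M

    lift<N : k < p → lift k < N
    lift<N k<p = <-≤-trans (+-monoˡ-< _ s<M) (*-monoˡ-≤ M k<p)

    lift-π : ∀ k → lift k % M ≡ s % M
    lift-π k = [m+kn]%n≡m%n s k M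

    lifts-inequivalent : k < m → m < p → ¬ OrbR N H (lift k) (lift m)
    lifts-inequivalent {k} {m} k<m m<p (h , h∈H , hx≡y) =
      <⇒≢ k<m (*-cancelʳ-≡ k m M (+-cancelˡ-≡ s _ _ (begin
        lift k             ≡⟨ m<n⇒m%n≡m (lift<N (<-trans k<m m<p)) ⟨
        lift k % N         ≡⟨ act-1 N (lift k) ⟨
        act N 1 (lift k)   ≡⟨ cong (λ t → act N t (lift k)) (sym h≡1) ⟩
        act N h (lift k)   ≡⟨ trans (sym (mod≡% _ N)) hx≡y ⟩
        lift m             ∎)))
      where
      open ≡-Reasoning
      h≡1 : h ≡ 1
      h≡1 = stabiliser-trivial r h∈H (>⇒∤ {{>-nonZero 0<s}} s<M) (begin
        act M h s             ≡⟨ act-%ʳ M h s ⟨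
        act M h (s % M)       ≡⟨ cong (act M h) (lift-π k) ⟨
        act M h (lift k % M)  ≡⟨ act-%ʳ M h (lift k) ⟩
        act M h (lift k)      ≡⟨ act-π h (lift k) ⟨
        act N h (lift k) % M  ≡⟨ cong (_% M) (trans (sym (mod≡% _ N)) hx≡y) ⟩
        lift m % M            ≡⟨ lift-π m ⟩
        s % M                 ∎)

    lifts-cover : x < N → OrbS M H s (x mod M) → Any (λ z → OrbR N H z x) (applyUpTo lift p)
    lifts-cover {x} x<N (h , h∈H , hs≡x) with inverse h∈H
    ... | b , b∈H , bh≡1 =
      lose (subst (_∈ applyUpTo lift p) lift[z/M]≡z (∈-applyUpTo⁺ lift (m<n*o⇒m/o<n (m%n<n (b * x) N))))
           (orbitR h∈H (trans (act-inverse′ N b h x bh≡1) (m<n⇒m%n≡m x<N)))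
      where
      open ≡-Reasoning
      z = act N b x
      z-π : z % M ≡ s
      z-π = begin
        act N b x % M          ≡⟨ act-π b x ⟩
        act M b x              ≡⟨ act-%ʳ M b x ⟨
        act M b (x % M)        ≡⟨ cong (act M b) (trans (sym (mod≡% x M)) (sym hs≡x)) ⟩
        act M b ((h mod M * s) mod M) ≡⟨ cong (act M b) (mod-scale≡act M h s) ⟩
        act M b (act M h s)    ≡⟨ act-inverse M b h s (%-reduce (b * h) 1 M∣N bh≡1) ⟩
        s % M                  ≡⟨ m<n⇒m%n≡m s<M ⟩
        s                      ∎
      lift[z/M]≡z : lift (z / M) ≡ z
      lift[z/M]≡z = trans (cong (_+ z / M * M) (sym z-π)) (sym (m≡m%n+[m/n]*n z M))

    nonzero-fibre : FiberCard N M H s p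
    nonzero-fibre = applyUpTo lift p
      , record
        { reps-lt       = All.applyUpTo⁺₁ lift p lift<N
        ; reps-fiber    = All.applyUpTo⁺₂ lift p (λ k → orbitS-refl (sym (lift-π k)))
        ; reps-distinct = AllPairs.applyUpTo⁺₁ lift p lifts-inequivalent
        ; reps-cover    = λ x x<N → lifts-cover x<N
        }
      , length-applyUpTo lift p

  module ZeroFibre where

    multiple : ℕ → ℕ
    multiple k = suc k * M

    D : List ℕ
    D = applyUpTo multiple (p ∸ 1)

    D! : Unique D
    D! = Unique.applyUpTo⁺₁ multiple (p ∸ 1)
           (λ k<m _ eq → <⇒≢ k<m (suc-injective (*-cancelʳ-≡ _ _ M eq)))

    ∈D⇒ : x ∈ D → 0 < x × x < N × x % M ≡ 0
    ∈D⇒ x∈D with ∈-applyUpTo⁻ multiple x∈D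
    ... | k , k<p∸1 , refl =
      >-nonZero⁻¹ _ {{m*n≢0 (suc k) M}} ,
      *-monoˡ-< M (<-≤-trans (s≤s k<p∸1) (≤-reflexive suc[p∸1]≡p)) ,
      m*n%n≡0 (suc k) M

    ∣⇒∈D : 0 < x → x < N → M ∣ x → x ∈ D
    ∣⇒∈D ()  _   (divides zero    refl)
    ∣⇒∈D 0<x x<N (divides (suc k) refl) =
      ∈-applyUpTo⁺ multiple (∸-monoˡ-≤ 1 (*-cancelʳ-< M (suc k) p x<N))

    ⇒∈D : 0 < x → x < N → x % M ≡ 0 → x ∈ D
    ⇒∈D {x} 0<x x<N x%M≡0 = ∣⇒∈D 0<x x<N (m%n≡0⇒n∣m x M x%M≡0)

    act-∈D : h ∈ H → x ∈ D → act N h x ∈ D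
    act-∈D {h} {x} h∈H x∈D with ∈D⇒ x∈D
    ... | 0<x , x<N , x%M≡0 = ⇒∈D (n≢0⇒n>0 hx≢0) (m%n<n (h * x) N) (begin
      act N h x % M    ≡⟨ act-π h x ⟩
      act M h x        ≡⟨ act-%ʳ M h x ⟨
      act M h (x % M)  ≡⟨ cong (act M h) x%M≡0 ⟩
      act M h 0        ≡⟨ act-0 M h ⟩
      0                ∎)
      where
      open ≡-Reasoning
      hx≢0 : act N h x ≢ 0
      hx≢0 hx≡0 = <⇒≢ 0<x (sym (begin
        x          ≡⟨ m<n⇒m%n≡m x<N ⟨
        x % N      ≡⟨ act-cancel h∈H (trans hx≡0 (sym (act-0 N h))) ⟩
        0 % N      ≡⟨ m<n⇒m%n≡m (>-nonZero⁻¹ N) ⟩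
        0          ∎))

    free : h ∈ H → h′ ∈ H → x ∈ D → act N h x ≡ act N h′ x → h ≡ h′
    free {x = x} h∈H h′∈H x∈D with ∈D⇒ x∈D
    ... | 0<x , x<N , _ = trivial-stabiliser⇒free x<N
      (λ g∈H gx≡x → stabiliser-trivial (suc r) g∈H (>⇒∤ {{>-nonZero 0<x}} x<N)
                                      (trans gx≡x (sym (m<n⇒m%n≡m x<N))))
      h∈H h′∈H

    open FreeOrbits D D! (All.tabulate (λ x∈D → proj₁ (proj₂ (∈D⇒ x∈D)))) act-∈D free

    rep⇒ : y ∈ reps → 0 < y × y < N × y % M ≡ 0
    rep⇒ y∈ = ∈D⇒ (reps⊆D y∈)

    length-reps≡ : length reps ≡ (p ∸ 1) / e
    length-reps≡ = sym (begin
      (p ∸ 1) / e           ≡⟨ cong (_/ e) (length-applyUpTo multiple (p ∸ 1)) ⟨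
      length D / e          ≡⟨ cong (_/ e) length-reps ⟨
      length reps * e / e   ≡⟨ m*n/n≡m (length reps) e ⟩
      length reps           ∎)
      where open ≡-Reasoning

    zero-fibre : FiberCard N M H 0 (1 + (p ∸ 1) / e)
    zero-fibre = 0 ∷ reps
      , record
        { reps-lt       = >-nonZero⁻¹ N ∷ All.tabulate (λ y∈ → proj₁ (proj₂ (rep⇒ y∈)))
        ; reps-fiber    = orbitS-refl refl
                          ∷ All.tabulate (λ y∈ → orbitS-refl (trans 0%M≡0 (sym (proj₂ (proj₂ (rep⇒ y∈))))))
        ; reps-distinct = All.tabulate (λ y∈ → 0≁rep (proj₁ (rep⇒ y∈))) ∷ reps-inequivalent
        ; reps-cover    = cover
        }
      , cong suc length-reps≡
      where
      0%M≡0 : 0 % M ≡ 0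
      0%M≡0 = m<n⇒m%n≡m (>-nonZero⁻¹ M)
      0≁rep : 0 < y → ¬ OrbR N H 0 y
      0≁rep 0<y (h , _ , h0≡y) = <⇒≢ 0<y (trans (sym (act-0 N h)) (trans (sym (mod≡% (h * 0) N)) h0≡y))
      cover : ∀ x → x < N → OrbS M H 0 (x mod M) → Any (λ z → OrbR N H z x) (0 ∷ reps)
      cover x x<N 0∼x with x ≟ 0
      ... | yes refl = here (orbitR 1∈H (act-0 N 1))
      ... | no  x≢0  =
        there (∃∈-Any (reps-represent (⇒∈D (n≢0⇒n>0 x≢0) x<N (trans (sym (mod≡% x M)) (orbitS-0 0∼x)))))

lemma6p4 : (p r e : ℕ) → Prime p → p ≢ 2 → 1 ≤ r → e ∣ p ∸ 1 → .{{_ : NonZero e}}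
           → (H : List ℕ) → IsUnitSubgroup (p ^ r) e H
           → (s : ℕ) → s < p ^ (r ∸ 1)
           → (OrbS (p ^ (r ∸ 1)) H 0 s → FiberCard (p ^ r) (p ^ (r ∸ 1)) H s (1 + (p ∸ 1) / e))
           × (¬ OrbS (p ^ (r ∸ 1)) H 0 s → FiberCard (p ^ r) (p ^ (r ∸ 1)) H s p)
lemma6p4 p zero    e _       _ () _     _ _ _ _
lemma6p4 p (suc r) e p-prime _ _  e∣p∸1 H G s s<M = over-zero , over-nonzero
  where
  open PrimePowerModulus {r = r} p-prime e∣p∸1 G
  over-zero : OrbS M H 0 s → FiberCard N M H s (1 + (p ∸ 1) / e)
  over-zero 0∼s = subst (λ t → FiberCard N M H t _) (sym (orbitS-0 0∼s)) ZeroFibre.zero-fibre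
  over-nonzero : ¬ OrbS M H 0 s → FiberCard N M H s p
  over-nonzero 0≁s = NonzeroFibre.nonzero-fibre (n≢0⇒n>0 s≢0) s<M
    where
    s≢0 : s ≢ 0
    s≢0 refl = 0≁s (orbitS 1∈H (act-0 M 1))
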